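{- Every tree $T$ with at least one edge admits an odd-edge edge-difference total coloring.
   Context: For a tree $T$ with $q\ge1$ edges, $[0,2q-1]=\{0,1,\dots,2q-1\}$ and $[1,2q-1]^o$ is the set of odd integers in $[1,2q-1]$. An odd-edge edge-difference total coloring of $T$ is a map $h:V(T)\cup E(T)\to[0,2q-1]$ (vertex colors need not be distinct) such that $\{h(e):e\in E(T)\}=[1,2q-1]^o$ and there is a positive integer $k$ with $h(uv)+|h(u)-h(v)|=k$ for every edge $uv\in E(T)$. -}

module Defs where

open import Data.Nat using (ℕ; zero; suc; _+_; _*_; _∸_; _≤_; _<_; ∣_-_∣)
open import Data.Fin using (Fin; toℕ)
open import Data.Vec using (Vec; lookup; toList)
open import Data.List using (List; []; _∷_; _++_; [_])
open import Data.List.Relation.Unary.Linked using (Linked)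
open import Data.List.Relation.Unary.Unique.Propositional using (Unique)
open import Data.Product using (_×_; _,_; proj₁; proj₂; Σ; ∃)
open import Data.Sum using (_⊎_)
open import Relation.Binary.PropositionalEquality using (_≡_)
open import Relation.Nullary using (¬_)

EdgeList : ℕ → ℕ → Set
EdgeList n q = Vec (Fin n × Fin n) q

module _ {n q : ℕ} (E : EdgeList n q) where

  Adj : Fin n → Fin n → Set
  Adj u v = ∃ λ (i : Fin q) →
    (proj₁ (lookup E i) ≡ u × proj₂ (lookup E i) ≡ v) ⊎
    (proj₁ (lookup E i) ≡ v × proj₂ (lookup E i) ≡ u)

  -- simple graph: no loops (each edge stored as (u , v) with u < v)
  -- and no repeated edges
  IsSimple : Set
  IsSimple = ((i : Fin q) → toℕ (proj₁ (lookup E i)) < toℕ (proj₂ (lookup E i)))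
           × Unique (toList E)

  data Walk : Fin n → Fin n → Set where
    here : ∀ {u} → Walk u u
    step : ∀ {u w v} → Adj u w → Walk w v → Walk u v

  Connected : Set
  Connected = (u v : Fin n) → Walk u v

  HasCycle : Set
  HasCycle = Σ (Fin n) λ x → Σ (Fin n) λ y → Σ (Fin n) λ z → Σ (List (Fin n)) λ rest →
    Unique (x ∷ y ∷ z ∷ rest) × Linked Adj ((x ∷ y ∷ z ∷ rest) ++ [ x ])

  IsTree : Set
  IsTree = IsSimple × Connected × ¬ HasCycle

  Odd : ℕ → Set
  Odd m = ∃ λ j → m ≡ 2 * j + 1

  IsOddEdgeEdgeDiffTotalColoring : (Fin n → ℕ) → (Fin q → ℕ) → Set
  IsOddEdgeEdgeDiffTotalColoring hv he =
    ((v : Fin n) → hv v ≤ 2 * q ∸ 1) ×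
    ((i : Fin q) → he i ≤ 2 * q ∸ 1) ×
    ((i : Fin q) → Odd (he i) × 1 ≤ he i) ×
    ((m : ℕ) → Odd m → 1 ≤ m → m ≤ 2 * q ∸ 1 → ∃ λ (i : Fin q) → he i ≡ m) ×
    (∃ λ k → 1 ≤ k × ((i : Fin q) →
       he i + ∣ hv (proj₁ (lookup E i)) - hv (proj₂ (lookup E i)) ∣ ≡ k))

  HasOddEdgeEdgeDiffTotalColoring : Set
  HasOddEdgeEdgeDiffTotalColoring =
    Σ (Fin n → ℕ) λ hv → Σ (Fin q → ℕ) λ he → IsOddEdgeEdgeDiffTotalColoring hv he

{-# OPTIONS --safe #-}
module Submission where

-- Root the tree and order the q edges by increasing depth of their lower endpoint (the child);
-- the edge of rank r gets colour 2r+1 and weight (q-1) - r, so weights strictly decrease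
-- from the root outwards.  Label every vertex by the alternating sum w₁ - w₂ + w₃ - ⋯ of the
-- weights along its path from the root: because the weights decrease, all these sums lie in
-- [0, q-1], and adjacent labels differ by exactly the weight of the edge between them.  With
-- vertex colour 2·label every edge then sees 2r+1 + 2((q-1) - r) = 2q-1.
-- Acyclicity is used only to make the non-backtracking walk from a vertex to the root unique:
-- two different ones, glued where they part, give a closed non-backtracking walk, hence a cycle.

open import Defs
open import Data.Unit using (⊤; tt)
open import Data.Nat using (ℕ; suc; _+_; _*_; _∸_; _≤_; _<_; z≤n; s≤s; s≤s⁻¹; ∣_-_∣)
open import Data.Nat.Properties
open import Data.Nat.Tactic.RingSolver using (solve-∀)
open import Data.Fin using (Fin; toℕ; fromℕ<; punchOut) renaming (zero to fzero)
open import Data.Fin.Properties using (fromℕ<-injective; punchOut-injective; injective⇒≤; any?)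
  renaming (_≟_ to _≟ᶠ_; <-isStrictTotalOrder to <ᶠ-isStrictTotalOrder)
open import Data.Vec using (Vec; []; lookup; toList; tabulate) renaming (_∷_ to _∷ᵛ_)
open import Data.Vec.Properties using (lookup∘tabulate; lookup⇒[]=; []=⇒lookup)
open import Data.Vec.Relation.Unary.AllPairs using () renaming (_∷_ to _∷ᵛᵖ_; [] to []ᵛᵖ)
open import Data.Vec.Relation.Unary.All.Properties using (toList⁻)
import Data.Vec.Relation.Unary.Unique.Propositional as Vec
import Data.Vec.Relation.Unary.Unique.Propositional.Properties as Vec
open import Data.List using (List; []; _∷_; _++_; [_]; length; head; last; _ʳ++_)
open import Data.List.Properties using (∷-injectiveˡ)
open import Data.List.Membership.Propositional using (_∈_; _∉_)
open import Data.List.Membership.Propositional.Properties using (∈-∃++)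
open import Data.List.Relation.Unary.All using (All; []; _∷_)
import Data.List.Relation.Unary.All as All
open import Data.List.Relation.Unary.All.Properties using (++⁻ˡ; ++⁻ʳ; ¬Any⇒All¬)
open import Data.List.Relation.Unary.Any using (here; there)
import Data.List.Relation.Unary.Any as Any
open import Data.List.Relation.Unary.AllPairs using ([]; _∷_)
open import Data.List.Relation.Unary.Linked using (Linked; []; [-]; _∷_)
import Data.List.Relation.Unary.Linked as Linked
open import Data.List.Relation.Unary.Unique.Propositional using (Unique)
open import Data.List.Relation.Unary.Unique.Propositional.Properties using (Unique[x∷xs]⇒x∉xs)
open import Data.Maybe using (just)
open import Data.Maybe.Properties using (just-injective)
open import Data.Product using (_×_; _,_; proj₁; proj₂; ∃)
open import Data.Product.Relation.Binary.Lex.Strict using (×-isStrictTotalOrder)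
open import Data.Sign using (Sign; opposite) renaming (+ to plus; - to minus)
open import Data.Sum using (_⊎_; inj₁; inj₂)
open import Function using (_∘_)
open import Function.Definitions using (Injective)
open import Relation.Binary using (Rel; Symmetric; IsStrictTotalOrder; tri<; tri≈; tri>)
open import Relation.Binary.PropositionalEquality hiding ([_])
open import Relation.Nullary using (¬_; yes; no; does; contradiction)
open import Relation.Nullary.Decidable using (dec-true)

private
  variable
    A : Set
    x y : A
    xs ys : List A

Unique[xs++y∷ys]⇒Unique[y∷xs] : ∀ xs → Unique (xs ++ y ∷ ys) → Unique (y ∷ xs)
Unique[xs++y∷ys]⇒Unique[y∷xs] [] _ = [] ∷ []
Unique[xs++y∷ys]⇒Unique[y∷xs] (x ∷ xs) (x∉ ∷ u) with Unique[xs++y∷ys]⇒Unique[y∷xs] xs u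
... | y∉xs ∷ uxs = (≢-sym (All.head (++⁻ʳ xs x∉)) ∷ y∉xs) ∷ ++⁻ˡ xs x∉ ∷ uxs

Unique[xsʳ++ys]⇒Unique[ys] : ∀ xs → Unique (xs ʳ++ ys) → Unique ys
Unique[xsʳ++ys]⇒Unique[ys] [] u = u
Unique[xsʳ++ys]⇒Unique[ys] (_ ∷ xs) u with Unique[xsʳ++ys]⇒Unique[ys] xs u
... | _ ∷ u′ = u′

Unique[xsʳ++ys]⇒Disjoint : ∀ xs → Unique (xs ʳ++ ys) → x ∈ xs → x ∉ ys
Unique[xsʳ++ys]⇒Disjoint (x ∷ xs) u (here refl) = Unique[x∷xs]⇒x∉xs (Unique[xsʳ++ys]⇒Unique[ys] xs u)
Unique[xsʳ++ys]⇒Disjoint (_ ∷ xs) u (there x∈xs) x∈ys =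
  Unique[xsʳ++ys]⇒Disjoint xs u x∈xs (there x∈ys)

Linked-prefix : {R : A → A → Set} → ∀ xs → Linked R (xs ++ y ∷ ys) → Linked R (xs ++ [ y ])
Linked-prefix [] _ = [-]
Linked-prefix (_ ∷ []) (r ∷ _) = r ∷ [-]
Linked-prefix (_ ∷ x′ ∷ xs) (r ∷ rs) = r ∷ Linked-prefix (x′ ∷ xs) rs

last-∈ : ∀ xs → last xs ≡ just x → x ∈ xs
last-∈ (_ ∷ []) refl = here refl
last-∈ (_ ∷ z ∷ xs) eq = there (last-∈ (z ∷ xs) eq)

-- Non-backtracking walks

NonBacktracking : List A → Set
NonBacktracking (x ∷ y ∷ z ∷ xs) = x ≢ z × NonBacktracking (y ∷ z ∷ xs)
NonBacktracking _ = ⊤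

NonBacktracking-tail : ∀ xs → NonBacktracking (x ∷ xs) → NonBacktracking xs
NonBacktracking-tail [] _ = tt
NonBacktracking-tail (_ ∷ []) _ = tt
NonBacktracking-tail (_ ∷ _ ∷ _) (_ , nb) = nb

NonBacktrackingWalk : (A → A → Set) → List A → Set
NonBacktrackingWalk R xs = Linked R xs × NonBacktracking xs

joinAtFork : {R : A → A → Set} → Symmetric R → ∀ {v} xs ys →
             NonBacktrackingWalk R (v ∷ xs) → NonBacktrackingWalk R (v ∷ ys) →
             head xs ≢ head ys → NonBacktrackingWalk R (xs ʳ++ v ∷ ys)
joinAtFork R-sym [] ys _ walk _ = walk
joinAtFork R-sym {v} (x ∷ xs) ys (vx ∷ linked , nb) (linked′ , nb′) heads≢ =
  joinAtFork R-sym xs (v ∷ ys) (linked , NonBacktracking-tail (x ∷ xs) nb)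
    (R-sym vx ∷ linked′ , turn ys nb′ heads≢) (heads≢′ xs nb)
  where
  turn : ∀ ys → NonBacktracking (v ∷ ys) → just x ≢ head ys → NonBacktracking (x ∷ v ∷ ys)
  turn [] _ _ = tt
  turn (_ ∷ _) nb′ x≢y = x≢y ∘ cong just , nb′
  heads≢′ : ∀ xs → NonBacktracking (v ∷ x ∷ xs) → head xs ≢ just v
  heads≢′ [] _ ()
  heads≢′ (_ ∷ _) (v≢z , _) eq = v≢z (sym (just-injective eq))

-- Ranking along a strict total order

Fin-injective⇒surjective : ∀ {m} {f : Fin m → Fin m} → Injective _≡_ _≡_ f → ∀ t → ∃ λ i → f i ≡ t
Fin-injective⇒surjective {suc m} {f} f-injective t with any? (λ i → f i ≟ᶠ t)
... | yes hit = hit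
... | no miss = contradiction (injective⇒≤ g-injective) 1+n≰n
  where
  t≢f : ∀ i → t ≢ f i
  t≢f i = miss ∘ (i ,_) ∘ sym
  g : Fin (suc m) → Fin m
  g i = punchOut (t≢f i)
  g-injective : Injective _≡_ _≡_ g
  g-injective {i} {j} = f-injective ∘ punchOut-injective (t≢f i) (t≢f j)

module Ranking {a ℓ₁ ℓ₂} {K : Set a} {_≈_ : Rel K ℓ₁} {_≺_ : Rel K ℓ₂}
               (order : IsStrictTotalOrder _≈_ _≺_) {q : ℕ}
               (key : Fin q → K) (key-injective : ∀ {i j} → key i ≈ key j → i ≡ j) where

  open import Data.Fin.Subset as Subset using (Subset; ∣_∣)
  open import Data.Fin.Subset.Properties using (p⊂q⇒∣p∣<∣q∣; ∈⊤; ∣⊤∣≡n)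
  open IsStrictTotalOrder order using (compare; irrefl)
    renaming (_<?_ to _≺?_; trans to ≺-trans; module Eq to ≈)

  below : Fin q → Subset q
  below i = tabulate λ j → does (key j ≺? key i)

  ∈-below⁺ : ∀ {i j} → key j ≺ key i → j Subset.∈ below i
  ∈-below⁺ {i} {j} j≺i =
    lookup⇒[]= j (below i) (trans (lookup∘tabulate _ j) (dec-true (key j ≺? key i) j≺i))

  ∈-below⁻ : ∀ {i j} → j Subset.∈ below i → key j ≺ key i
  ∈-below⁻ {i} {j} j∈ with key j ≺? key i | trans (sym (lookup∘tabulate _ j)) ([]=⇒lookup j∈)
  ... | yes j≺i | _ = j≺i
  ... | no _ | ()

  rank : Fin q → ℕ
  rank i = ∣ below i ∣

  rank<q : ∀ i → rank i < q
  rank<q i = subst (rank i <_) (∣⊤∣≡n q)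
    (p⊂q⇒∣p∣<∣q∣ ((λ _ → ∈⊤) , i , ∈⊤ , irrefl ≈.refl ∘ ∈-below⁻))

  rank-monotone : ∀ {i j} → key i ≺ key j → rank i < rank j
  rank-monotone i≺j = p⊂q⇒∣p∣<∣q∣
    (∈-below⁺ ∘ (λ k≺i → ≺-trans k≺i i≺j) ∘ ∈-below⁻ , _ , ∈-below⁺ i≺j , irrefl ≈.refl ∘ ∈-below⁻)

  rank-injective : ∀ {i j} → rank i ≡ rank j → i ≡ j
  rank-injective {i} {j} eq with compare (key i) (key j)
  ... | tri< i≺j _ _ = contradiction eq (<⇒≢ (rank-monotone i≺j))
  ... | tri≈ _ i≈j _ = key-injective i≈j
  ... | tri> _ _ j≺i = contradiction (sym eq) (<⇒≢ (rank-monotone j≺i))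

  rank-surjective : ∀ t → t < q → ∃ λ i → rank i ≡ t
  rank-surjective t t<q =
    let i , eq = Fin-injective⇒surjective rankFin-injective (fromℕ< t<q)
    in i , fromℕ<-injective _ _ (rank<q i) t<q eq
    where
    rankFin : Fin q → Fin q
    rankFin i = fromℕ< (rank<q i)
    rankFin-injective : Injective _≡_ _≡_ rankFin
    rankFin-injective {i} {j} eq = rank-injective (fromℕ<-injective _ _ (rank<q i) (rank<q j) eq)

-- Alternating sums

signOf : List ℕ → Sign
signOf [] = plus
signOf (_ ∷ ds) = opposite (signOf ds)

applySign : Sign → ℕ → ℕ → ℕ
applySign plus s d = s + d
applySign minus s d = s ∸ d

-- Signs alternate and the last entry is added.  Subtraction truncates, so this is the genuine
-- alternating sum only when the entries increase along the list.
alternatingSum : List ℕ → ℕ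
alternatingSum [] = 0
alternatingSum (d ∷ ds) = applySign (signOf ds) (alternatingSum ds) d

module _ (m : ℕ) where

  -- The room that the sum s, whose first entry d came with sign σ, leaves inside [0, m] for a
  -- next entry below d, which comes with the opposite sign.
  Slack : Sign → ℕ → ℕ → Set
  Slack plus s d = d ≤ s
  Slack minus s d = s + d ≤ m

  Slack-step : ∀ σ s d e → d < e → s ≤ m → Slack σ s e →
               applySign (opposite σ) s d ≤ m × Slack (opposite σ) (applySign (opposite σ) s d) d
  Slack-step plus s d e d<e s≤m e≤s =
    ≤-trans (m∸n≤m s d) s≤m , ≤-trans (≤-reflexive (m∸n+n≡m (≤-trans (<⇒≤ d<e) e≤s))) s≤m
  Slack-step minus s d e d<e s≤m s+e≤m = ≤-trans (+-monoʳ-≤ s (<⇒≤ d<e)) s+e≤m , m≤n+m d s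

  alternatingSum-bounded : ∀ d ds → Linked _<_ (d ∷ ds) → All (_≤ m) (d ∷ ds) →
    alternatingSum (d ∷ ds) ≤ m × Slack (signOf ds) (alternatingSum (d ∷ ds)) d
  alternatingSum-bounded d [] _ (d≤m ∷ []) = d≤m , ≤-refl
  alternatingSum-bounded d (e ∷ ds) (d<e ∷ increasing) (_ ∷ bounded) =
    let s≤m , slack = alternatingSum-bounded e ds increasing bounded
    in Slack-step (signOf ds) (alternatingSum (e ∷ ds)) d e d<e s≤m slack

  alternatingSum-step : ∀ d ds → Linked _<_ (d ∷ ds) → All (_≤ m) ds →
                        ∣ alternatingSum (d ∷ ds) - alternatingSum ds ∣ ≡ d
  alternatingSum-step d [] _ _ = ∣-∣-identityʳ d
  alternatingSum-step d (e ∷ ds) (d<e ∷ increasing) bounded =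
    distance (signOf ds) (alternatingSum (e ∷ ds)) (proj₂ (alternatingSum-bounded e ds increasing bounded))
    where
    distance : ∀ σ s → Slack σ s e → ∣ applySign (opposite σ) s d - s ∣ ≡ d
    distance plus s e≤s = trans (m≤n⇒∣m-n∣≡n∸m (m∸n≤m s d)) (m∸[m∸n]≡n (≤-trans (<⇒≤ d<e) e≤s))
    distance minus s _ = trans (∣-∣-comm (s + d) s) (∣m-m+n∣≡n s d)

module _ {n q : ℕ} (E : EdgeList n q) where

  src tgt : Fin q → Fin n
  src i = proj₁ (lookup E i)
  tgt i = proj₂ (lookup E i)

  Joins : Fin q → Fin n → Fin n → Set
  Joins i a b = (src i ≡ a × tgt i ≡ b) ⊎ (src i ≡ b × tgt i ≡ a)

module SimpleGraph {n q : ℕ} {E : EdgeList n q} (simple : IsSimple E) where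

  src<tgt : ∀ i {a b} → src E i ≡ a → tgt E i ≡ b → toℕ a < toℕ b
  src<tgt i refl refl = proj₁ simple i

  lookup-injective : ∀ {i j} → lookup E i ≡ lookup E j → i ≡ j
  lookup-injective = Vec.lookup-injective (toVecUnique E (proj₂ simple)) _ _
    where
    toVecUnique : ∀ {m} (V : Vec (Fin n × Fin n) m) → Unique (toList V) → Vec.Unique V
    toVecUnique [] [] = []ᵛᵖ
    toVecUnique (_ ∷ᵛ V) (x∉ ∷ u) = toList⁻ x∉ ∷ᵛᵖ toVecUnique V u

  joins-sym : ∀ {i a b} → Joins E i a b → Joins E i b a
  joins-sym (inj₁ ends) = inj₂ ends
  joins-sym (inj₂ ends) = inj₁ ends

  joins-injective : ∀ {i j a b} → Joins E i a b → Joins E j a b → i ≡ j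
  joins-injective (inj₁ (s , t)) (inj₁ (s′ , t′)) =
    lookup-injective (cong₂ _,_ (trans s (sym s′)) (trans t (sym t′)))
  joins-injective (inj₂ (s , t)) (inj₂ (s′ , t′)) =
    lookup-injective (cong₂ _,_ (trans s (sym s′)) (trans t (sym t′)))
  joins-injective {i} {j} (inj₁ (s , t)) (inj₂ (s′ , t′)) =
    contradiction (src<tgt j s′ t′) (<⇒≯ (src<tgt i s t))
  joins-injective {i} {j} (inj₂ (s , t)) (inj₁ (s′ , t′)) =
    contradiction (src<tgt j s′ t′) (<⇒≯ (src<tgt i s t))

  joins-unordered : ∀ {i a b c d} → Joins E i a b → Joins E i c d → (a ≡ c × b ≡ d) ⊎ (a ≡ d × b ≡ c)
  joins-unordered (inj₁ (s , t)) (inj₁ (s′ , t′)) = inj₁ (trans (sym s) s′ , trans (sym t) t′)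
  joins-unordered (inj₁ (s , t)) (inj₂ (s′ , t′)) = inj₂ (trans (sym s) s′ , trans (sym t) t′)
  joins-unordered (inj₂ (s , t)) (inj₁ (s′ , t′)) = inj₂ (trans (sym t) t′ , trans (sym s) s′)
  joins-unordered (inj₂ (s , t)) (inj₂ (s′ , t′)) = inj₁ (trans (sym t) t′ , trans (sym s) s′)

  Adj-sym : Symmetric (Adj E)
  Adj-sym (i , joins) = i , joins-sym joins

  Adj-irrefl : ∀ {a} → ¬ Adj E a a
  Adj-irrefl (i , inj₁ (s , t)) = <-irrefl refl (src<tgt i s t)
  Adj-irrefl (i , inj₂ (s , t)) = <-irrefl refl (src<tgt i s t)

  closedWalk⇒cycle : ∀ {x} pre post → NonBacktrackingWalk (Adj E) (x ∷ pre ++ x ∷ post) →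
                     Unique (x ∷ pre) → HasCycle E
  closedWalk⇒cycle [] _ (xx ∷ _ , _) _ = contradiction xx Adj-irrefl
  closedWalk⇒cycle (_ ∷ []) _ (_ , x≢x , _) _ = contradiction refl x≢x
  closedWalk⇒cycle {x} (y ∷ z ∷ rest) _ (linked , _) u =
    x , y , z , rest , u , Linked-prefix (x ∷ y ∷ z ∷ rest) linked

  nonBacktrackingWalk⇒cycle⊎unique : ∀ xs → NonBacktrackingWalk (Adj E) xs → HasCycle E ⊎ Unique xs
  nonBacktrackingWalk⇒cycle⊎unique [] _ = inj₂ []
  nonBacktrackingWalk⇒cycle⊎unique (x ∷ xs) walk@(linked , nb)
    with nonBacktrackingWalk⇒cycle⊎unique xs (Linked.tail linked , NonBacktracking-tail xs nb)
  ... | inj₁ cycle = inj₁ cycle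
  ... | inj₂ u with Any.any? (x ≟ᶠ_) xs
  ... | no x∉xs = inj₂ (¬Any⇒All¬ xs x∉xs ∷ u)
  ... | yes x∈xs with pre , post , refl ← ∈-∃++ x∈xs =
    inj₁ (closedWalk⇒cycle pre post walk (Unique[xs++y∷ys]⇒Unique[y∷xs] pre u))

-- Rooted trees

module RootedTree {n q : ℕ} {E : EdgeList n q} (tree : IsTree E) (root : Fin n) where

  open SimpleGraph (proj₁ tree)

  nonBacktrackingWalk-unique : ∀ xs → NonBacktrackingWalk (Adj E) xs → Unique xs
  nonBacktrackingWalk-unique xs walk with nonBacktrackingWalk⇒cycle⊎unique xs walk
  ... | inj₁ cycle = contradiction cycle (proj₂ (proj₂ tree))
  ... | inj₂ u = u

  RootWalk : List (Fin n) → Set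
  RootWalk xs = NonBacktrackingWalk (Adj E) xs × last xs ≡ just root

  RootWalk-tail : ∀ {v u} t → RootWalk (v ∷ u ∷ t) → RootWalk (u ∷ t)
  RootWalk-tail t ((_ ∷ linked , nb) , ends) = (linked , NonBacktracking-tail (_ ∷ t) nb) , ends

  RootWalk-start≢root : ∀ {v u} t → RootWalk (v ∷ u ∷ t) → v ≢ root
  RootWalk-start≢root t (walk , ends) with nonBacktrackingWalk-unique _ walk
  ... | v∉ ∷ _ = All.lookup v∉ (last-∈ (_ ∷ t) ends)

  RootWalk-unique : ∀ {v} t t′ → RootWalk (v ∷ t) → RootWalk (v ∷ t′) → t ≡ t′
  RootWalk-unique [] [] _ _ = refl
  RootWalk-unique [] (_ ∷ t′) (_ , refl) w′ = contradiction refl (RootWalk-start≢root t′ w′)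
  RootWalk-unique (_ ∷ t) [] w (_ , refl) = contradiction refl (RootWalk-start≢root t w)
  RootWalk-unique {v} (x ∷ t) (y ∷ t′) w@(walk , ends) w′@(walk′ , ends′) with x ≟ᶠ y
  ... | yes refl = cong (x ∷_) (RootWalk-unique t t′ (RootWalk-tail t w) (RootWalk-tail t′ w′))
  ... | no x≢y = contradiction (there (last-∈ (x ∷ t) ends))
                               (Unique[xsʳ++ys]⇒Disjoint (y ∷ t′) closed (last-∈ (y ∷ t′) ends′))
    where
    closed : Unique ((y ∷ t′) ʳ++ v ∷ x ∷ t)
    closed = nonBacktrackingWalk-unique _
      (joinAtFork Adj-sym (y ∷ t′) (x ∷ t) walk′ walk (x≢y ∘ sym ∘ just-injective))

  RootWalk-step : ∀ {u w} t → RootWalk (u ∷ t) → Adj E u w →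
                  RootWalk (w ∷ u ∷ t) ⊎ ∃ λ s → t ≡ w ∷ s
  RootWalk-step [] (_ , ends) uw = inj₁ ((Adj-sym uw ∷ [-] , tt) , ends)
  RootWalk-step {w = w} (y ∷ t) ((linked , nb) , ends) uw with w ≟ᶠ y
  ... | yes refl = inj₂ (t , refl)
  ... | no w≢y = inj₁ ((Adj-sym uw ∷ linked , w≢y , nb) , ends)

  rootWalk-exists : ∀ v → ∃ λ t → RootWalk (v ∷ t)
  rootWalk-exists v = extend (proj₁ (proj₂ tree) root v) ([] , ([-] , tt) , refl)
    where
    extend : ∀ {u v} → Walk E u v → ∃ (λ t → RootWalk (u ∷ t)) → ∃ λ t → RootWalk (v ∷ t)
    extend here walk = walk
    extend (step uw rest) (t , walk) with RootWalk-step t walk uw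
    ... | inj₁ walk′ = extend rest (_ , walk′)
    ... | inj₂ (s , refl) = extend rest (s , RootWalk-tail s walk)

  opaque
    toRoot : Fin n → List (Fin n)
    toRoot v = proj₁ (rootWalk-exists v)

    rootWalk : ∀ v → RootWalk (v ∷ toRoot v)
    rootWalk v = proj₂ (rootWalk-exists v)

  rootWalk-≡ : ∀ {v t} → toRoot v ≡ t → RootWalk (v ∷ t)
  rootWalk-≡ {v} eq = subst (λ t → RootWalk (v ∷ t)) eq (rootWalk v)

  toRoot-unique : ∀ {v} t → RootWalk (v ∷ t) → toRoot v ≡ t
  toRoot-unique t = RootWalk-unique _ t (rootWalk _)

  ParentOf : Fin n → Fin n → Set
  ParentOf p c = toRoot c ≡ p ∷ toRoot p

  RootWalk⇒ParentOf : ∀ {v u} t → RootWalk (v ∷ u ∷ t) → ParentOf u v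
  RootWalk⇒ParentOf t w = trans (toRoot-unique _ w) (cong (_ ∷_) (sym (toRoot-unique t (RootWalk-tail t w))))

  ParentOf-asym : ∀ {a b} → ParentOf a b → ¬ ParentOf b a
  ParentOf-asym {a} {b} ab ba = 1+n≰n (begin
    suc (length (toRoot a)) ≡⟨ cong length (sym ab) ⟩
    length (toRoot b)       <⟨ ≤-reflexive (cong length (sym ba)) ⟩
    length (toRoot a)       ∎)
    where open ≤-Reasoning

  Adj⇒ParentOf : ∀ {a b} → Adj E a b → ParentOf a b ⊎ ParentOf b a
  Adj⇒ParentOf {a} ab with RootWalk-step (toRoot a) (rootWalk a) ab
  ... | inj₁ walk = inj₁ (RootWalk⇒ParentOf (toRoot a) walk)
  ... | inj₂ (s , eq) = inj₂ (RootWalk⇒ParentOf s (rootWalk-≡ eq))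

  record Orientation (i : Fin q) : Set where
    field
      child parent : Fin n
      parentOf : ParentOf parent child
      joins : Joins E i parent child

  orient : ∀ i → Orientation i
  orient i with Adj⇒ParentOf (i , inj₁ (refl , refl))
  ... | inj₁ p = record { parentOf = p ; joins = inj₁ (refl , refl) }
  ... | inj₂ p = record { parentOf = p ; joins = inj₂ (refl , refl) }

  child : Fin q → Fin n
  child i = Orientation.child (orient i)

  child-injective : ∀ {i j} → child i ≡ child j → i ≡ j
  child-injective {i} {j} eq with orient i | orient j
  ... | record { parentOf = pᵢ ; joins = joinsᵢ } | record { parentOf = pⱼ ; joins = joinsⱼ }
    with refl ← eq with refl ← ∷-injectiveˡ (trans (sym pᵢ) pⱼ) = joins-injective joinsᵢ joinsⱼ

  ParentOf⇒child : ∀ {p c} → ParentOf p c → ∃ λ i → child i ≡ c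
  ParentOf⇒child pc with rootWalk-≡ pc
  ... | ((i , joins) ∷ _ , _) , _ with joins-unordered joins (Orientation.joins (orient i))
  ... | inj₁ (c≡parent , p≡child) =
    contradiction (subst₂ ParentOf (sym c≡parent) (sym p≡child) (Orientation.parentOf (orient i)))
                  (ParentOf-asym pc)
  ... | inj₂ (c≡child , _) = i , sym c≡child

  depth : Fin q → ℕ
  depth i = length (toRoot (child i))

2[1+m]∸1≡2m+1 : ∀ m → 2 * suc m ∸ 1 ≡ 2 * m + 1
2[1+m]∸1≡2m+1 m = trans (+-suc m (m + 0)) (+-comm 1 (2 * m))

2j+1≤2[1+m]∸1⇒j<1+m : ∀ {j m} → 2 * j + 1 ≤ 2 * suc m ∸ 1 → j < suc m
2j+1≤2[1+m]∸1⇒j<1+m {j} {m} le =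
  s≤s (*-cancelˡ-≤ 2 (+-cancelʳ-≤ 1 (2 * j) (2 * m) (subst (2 * j + 1 ≤_) (2[1+m]∸1≡2m+1 m) le)))

2r+1+2[m∸r]≡2m+1 : ∀ {r m} → r ≤ m → 2 * r + 1 + 2 * (m ∸ r) ≡ 2 * m + 1
2r+1+2[m∸r]≡2m+1 {r} {m} r≤m = trans (rearrange r (m ∸ r)) (cong (λ x → 2 * x + 1) (m∸n+n≡m r≤m))
  where
  rearrange : ∀ r d → 2 * r + 1 + 2 * d ≡ 2 * (d + r) + 1
  rearrange = solve-∀

module Colouring {n m : ℕ} {E : EdgeList n (suc m)} (tree : IsTree E) where

  open RootedTree tree (src E fzero)
  open Ranking (×-isStrictTotalOrder <-isStrictTotalOrder <ᶠ-isStrictTotalOrder) (λ i → depth i , i) proj₂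

  rank≤m : ∀ i → rank i ≤ m
  rank≤m i = s≤s⁻¹ (rank<q i)

  edgeWeight : Fin (suc m) → ℕ
  edgeWeight i = m ∸ rank i

  -- The weight of the edge from v to its parent (0 at the root).
  parentWeight : Fin n → ℕ
  parentWeight v with any? (λ i → child i ≟ᶠ v)
  ... | yes (i , _) = edgeWeight i
  ... | no _ = 0

  parentWeight≤m : ∀ v → parentWeight v ≤ m
  parentWeight≤m v with any? (λ i → child i ≟ᶠ v)
  ... | yes (i , _) = m∸n≤m m (rank i)
  ... | no _ = z≤n

  parentWeight-child : ∀ i → parentWeight (child i) ≡ edgeWeight i
  parentWeight-child i with any? (λ j → child j ≟ᶠ child i)
  ... | yes (j , eq) = cong edgeWeight (child-injective eq)
  ... | no miss = contradiction (i , refl) miss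

  parentWeight-decreasing : ∀ {g p c} → ParentOf p c → ParentOf g p → parentWeight c < parentWeight p
  parentWeight-decreasing pc gp with i , refl ← ParentOf⇒child pc | j , refl ← ParentOf⇒child gp =
    subst₂ _<_ (sym (parentWeight-child i)) (sym (parentWeight-child j))
      (∸-monoʳ-< (rank-monotone (inj₁ deeper)) (rank≤m i))
    where
    deeper : depth j < depth i
    deeper = ≤-reflexive (cong length (sym pc))

  edgeWeights : List (Fin n) → List ℕ
  edgeWeights (v ∷ u ∷ t) = parentWeight v ∷ edgeWeights (u ∷ t)
  edgeWeights _ = []

  edgeWeights-increasing : ∀ v t → RootWalk (v ∷ t) → Linked _<_ (edgeWeights (v ∷ t))
  edgeWeights-increasing _ [] _ = []
  edgeWeights-increasing _ (_ ∷ []) _ = [-]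
  edgeWeights-increasing v (u ∷ w ∷ t) walk =
    parentWeight-decreasing (RootWalk⇒ParentOf (w ∷ t) walk) (RootWalk⇒ParentOf t (RootWalk-tail (w ∷ t) walk))
    ∷ edgeWeights-increasing u (w ∷ t) (RootWalk-tail (w ∷ t) walk)

  edgeWeights-bounded : ∀ vs → All (_≤ m) (edgeWeights vs)
  edgeWeights-bounded (v ∷ u ∷ t) = parentWeight≤m v ∷ edgeWeights-bounded (u ∷ t)
  edgeWeights-bounded [] = []
  edgeWeights-bounded (_ ∷ []) = []

  label : Fin n → ℕ
  label v = alternatingSum (edgeWeights (v ∷ toRoot v))

  label≤m : ∀ v → label v ≤ m
  label≤m v with toRoot v | rootWalk v
  ... | [] | _ = z≤n
  ... | u ∷ t | walk = proj₁ (alternatingSum-bounded m (parentWeight v) (edgeWeights (u ∷ t))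
                          (edgeWeights-increasing v (u ∷ t) walk) (edgeWeights-bounded (v ∷ u ∷ t)))

  label-ParentOf : ∀ {p c} → ParentOf p c → ∣ label c - label p ∣ ≡ parentWeight c
  label-ParentOf {p} {c} pc = trans (cong (λ t → ∣ alternatingSum (edgeWeights (c ∷ t)) - label p ∣) pc)
    (alternatingSum-step m (parentWeight c) (edgeWeights (p ∷ toRoot p))
      (edgeWeights-increasing c (p ∷ toRoot p) (rootWalk-≡ pc)) (edgeWeights-bounded (p ∷ toRoot p)))

  label-edge : ∀ i → ∣ label (src E i) - label (tgt E i) ∣ ≡ edgeWeight i
  label-edge i = trans (endpoints joins) (trans (label-ParentOf parentOf) (parentWeight-child i))
    where
    open Orientation (orient i) using (parent; parentOf; joins)
    endpoints : Joins E i parent (child i) →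
                ∣ label (src E i) - label (tgt E i) ∣ ≡ ∣ label (child i) - label parent ∣
    endpoints (inj₁ (s , t)) = trans (cong₂ (λ a b → ∣ label a - label b ∣) s t) (∣-∣-comm (label parent) _)
    endpoints (inj₂ (s , t)) = cong₂ (λ a b → ∣ label a - label b ∣) s t

  vertexColour : Fin n → ℕ
  vertexColour v = 2 * label v

  edgeColour : Fin (suc m) → ℕ
  edgeColour i = 2 * rank i + 1

  isColouring : IsOddEdgeEdgeDiffTotalColoring E vertexColour edgeColour
  isColouring =
    vertexColour≤ , edgeColour≤ , edgeColour-odd , edgeColour-onto , 2 * m + 1 , m≤n+m 1 (2 * m) , edgeSum
    where
    vertexColour≤ : ∀ v → vertexColour v ≤ 2 * suc m ∸ 1
    vertexColour≤ v = subst (vertexColour v ≤_) (sym (2[1+m]∸1≡2m+1 m))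
      (≤-trans (*-monoʳ-≤ 2 (label≤m v)) (m≤m+n (2 * m) 1))

    edgeColour≤ : ∀ i → edgeColour i ≤ 2 * suc m ∸ 1
    edgeColour≤ i = subst (edgeColour i ≤_) (sym (2[1+m]∸1≡2m+1 m)) (+-monoˡ-≤ 1 (*-monoʳ-≤ 2 (rank≤m i)))

    edgeColour-odd : ∀ i → Odd E (edgeColour i) × 1 ≤ edgeColour i
    edgeColour-odd i = (rank i , refl) , m≤n+m 1 (2 * rank i)

    edgeColour-onto : ∀ c → Odd E c → 1 ≤ c → c ≤ 2 * suc m ∸ 1 → ∃ λ i → edgeColour i ≡ c
    edgeColour-onto _ (j , refl) _ c≤ =
      let i , rank≡j = rank-surjective j (2j+1≤2[1+m]∸1⇒j<1+m c≤)
      in i , cong (λ r → 2 * r + 1) rank≡j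

    edgeSum : ∀ i → edgeColour i + ∣ vertexColour (src E i) - vertexColour (tgt E i) ∣ ≡ 2 * m + 1
    edgeSum i = begin
      2 * rank i + 1 + ∣ 2 * label (src E i) - 2 * label (tgt E i) ∣
        ≡⟨ cong (2 * rank i + 1 +_) (sym (*-distribˡ-∣-∣ 2 (label (src E i)) _)) ⟩
      2 * rank i + 1 + 2 * ∣ label (src E i) - label (tgt E i) ∣
        ≡⟨ cong (λ d → 2 * rank i + 1 + 2 * d) (label-edge i) ⟩
      2 * rank i + 1 + 2 * (m ∸ rank i)
        ≡⟨ 2r+1+2[m∸r]≡2m+1 (rank≤m i) ⟩
      2 * m + 1 ∎
      where open ≡-Reasoning

mainTheorem10 : (n q : ℕ) (E : EdgeList n q) → IsTree E → 1 ≤ q →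
    HasOddEdgeEdgeDiffTotalColoring E
mainTheorem10 n (suc m) E tree _ = vertexColour , edgeColour , isColouring
  where open Colouring tree
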